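{- Let $f$ be a crooked function over $\mathbb F_{2^n}$ and define $c_f((x,x_1),(y,y_1))=f(x+y)+f(x)+f(y)+f(x_1y+y_1x)$ for $(x,x_1),(y,y_1)\in\mathbb F_{2^n}\times\mathbb F_2$. Then $c_f$ induces a coloring of the lines of $\mathrm{PG}(n,2)$ with colors in $\mathbb F_{2^n}^*$: for any distinct nonzero $u,v\in\mathbb F_{2^n}\times\mathbb F_2$ we have $c_f(u,v)=c_f(u,u+v)=c_f(v,u+v)\in\mathbb F_{2^n}^*$, so the value depends only on the line $\{u,v,u+v\}$.
   Context: A function $f:\mathbb F_{2^n}\to\mathbb F_{2^n}$ is crooked if (1) $f(0)=0$; (2) $f(x)+f(y)+f(z)+f(x+y+z)\neq0$ for any three distinct $x,y,z$; (3) $f(x)+f(y)+f(z)+f(x+a)+f(y+a)+f(z+a)\neq0$ for any $a\neq0$ and any $x,y,z$. $\mathrm{PG}(n,2)$ is identified with the nonzero vectors of $\mathbb F_2^{n+1}\cong\mathbb F_{2^n}\times\mathbb F_2$; its lines are the sets $\{u,v,u+v\}$ with $u\ne v$ nonzero. -}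

module Defs where

open import Data.Nat using (ℕ)
open import Data.Bool using (Bool; true; false; _xor_; if_then_else_)
open import Data.Vec using (Vec; zipWith; replicate)
open import Data.Product using (_×_; _,_)
open import Relation.Binary.PropositionalEquality using (_≡_; _≢_)

-- The additive group of F_{2^n}, i.e. F_2^n (coordinates w.r.t. an F_2-basis).
-- Only addition and multiplication by elements of F_2 ⊆ F_{2^n} occur
-- in the statement, so the field multiplication is not needed.
F : ℕ → Set
F n = Vec Bool n

infixl 6 _⊕_
_⊕_ : {n : ℕ} → F n → F n → F n
_⊕_ = zipWith _xor_

𝟎 : {n : ℕ} → F n
𝟎 = replicate _ false

_·_ : {n : ℕ} → Bool → F n → F n
b · x = if b then x else 𝟎

record Crooked {n : ℕ} (f : F n → F n) : Set where
  field
    zero-fixed : f 𝟎 ≡ 𝟎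
    cond2 : (x y z : F n) → x ≢ y → x ≢ z → y ≢ z →
            f x ⊕ f y ⊕ f z ⊕ f (x ⊕ y ⊕ z) ≢ 𝟎
    cond3 : (a : F n) → a ≢ 𝟎 → (x y z : F n) →
            f x ⊕ f y ⊕ f z ⊕ f (x ⊕ a) ⊕ f (y ⊕ a) ⊕ f (z ⊕ a) ≢ 𝟎

-- Points of F_{2^n} × F_2 (PG(n,2) = its nonzero elements)
P : ℕ → Set
P n = F n × Bool

infixl 6 _⊞_
_⊞_ : {n : ℕ} → P n → P n → P n
(x , x₁) ⊞ (y , y₁) = (x ⊕ y) , (x₁ xor y₁)

𝟎ₚ : {n : ℕ} → P n
𝟎ₚ = 𝟎 , false

c : {n : ℕ} → (F n → F n) → P n → P n → F n
c f (x , x₁) (y , y₁) = f (x ⊕ y) ⊕ f x ⊕ f y ⊕ f ((x₁ · y) ⊕ (y₁ · x))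

-- The value c_f(u,v) splits as Δ f x y ⊕ f (ω u v) with Δ f x y = f(x+y)+f(x)+f(y) and
-- ω (x,x₁) (y,y₁) = x₁y + y₁x. Replacing v by u+v (or u by v, v by u+v) only permutes
-- x, y, x+y inside Δ and leaves ω unchanged, so c_f is constant on lines. For non-vanishing,
-- a line either lies in the hyperplane x₁ = 0, where c_f(u,v) = f(x+y)+f(x)+f(y) ≠ 0 by the
-- second crookedness condition at z = 0, or it can be written with u = (x,1), v = (y,0), where
-- c_f(u,v) = f(x)+f(x+y) ≠ 0 by the third condition at x = y = z.
module Submission where

open import Defs
open import Algebra.Bundles using (CommutativeSemigroup)
import Algebra.Properties.CommutativeSemigroup as CommSemigroupProperties
open import Data.Nat using (ℕ)
open import Data.Bool using (true; false)
open import Data.Bool.Properties using (xor-assoc; xor-comm; xor-identityˡ; xor-identityʳ; xor-same)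
open import Data.Vec using ([]; _∷_)
open import Data.Vec.Properties using (zipWith-assoc; zipWith-comm; zipWith-identityˡ; zipWith-identityʳ)
open import Data.Product using (_×_; _,_)
open import Function using (_∘_)
open import Relation.Binary.PropositionalEquality
  using (_≡_; _≢_; refl; cong; cong₂; sym; trans; subst; isEquivalence; module ≡-Reasoning)

private
  variable
    n : ℕ

⊕-assoc : (x y z : F n) → x ⊕ y ⊕ z ≡ x ⊕ (y ⊕ z)
⊕-assoc = zipWith-assoc xor-assoc

⊕-comm : (x y : F n) → x ⊕ y ≡ y ⊕ x
⊕-comm = zipWith-comm xor-comm

⊕-identityˡ : (x : F n) → 𝟎 ⊕ x ≡ x
⊕-identityˡ = zipWith-identityˡ xor-identityˡ

⊕-identityʳ : (x : F n) → x ⊕ 𝟎 ≡ x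
⊕-identityʳ = zipWith-identityʳ xor-identityʳ

⊕-self : (x : F n) → x ⊕ x ≡ 𝟎
⊕-self []      = refl
⊕-self (b ∷ x) = cong₂ _∷_ (xor-same b) (⊕-self x)

⊕-cancelˡ : (x y : F n) → x ⊕ (x ⊕ y) ≡ y
⊕-cancelˡ x y = begin
  x ⊕ (x ⊕ y) ≡⟨ sym (⊕-assoc x x y) ⟩
  x ⊕ x ⊕ y   ≡⟨ cong (_⊕ y) (⊕-self x) ⟩
  𝟎 ⊕ y       ≡⟨ ⊕-identityˡ y ⟩
  y           ∎
  where open ≡-Reasoning

⊕-cancelʳ : (x y : F n) → x ⊕ y ⊕ y ≡ x
⊕-cancelʳ x y = begin
  x ⊕ y ⊕ y   ≡⟨ ⊕-assoc x y y ⟩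
  x ⊕ (y ⊕ y) ≡⟨ cong (x ⊕_) (⊕-self y) ⟩
  x ⊕ 𝟎       ≡⟨ ⊕-identityʳ x ⟩
  x           ∎
  where open ≡-Reasoning

⊕≡𝟎⇒≡ : (x y : F n) → x ⊕ y ≡ 𝟎 → x ≡ y
⊕≡𝟎⇒≡ x y x⊕y≡𝟎 = begin
  x           ≡⟨ sym (⊕-cancelʳ x y) ⟩
  x ⊕ y ⊕ y   ≡⟨ cong (_⊕ y) x⊕y≡𝟎 ⟩
  𝟎 ⊕ y       ≡⟨ ⊕-identityˡ y ⟩
  y           ∎
  where open ≡-Reasoning

⊕-commutativeSemigroup : ℕ → CommutativeSemigroup _ _
⊕-commutativeSemigroup n = record
  { Carrier                = F n
  ; _≈_                    = _≡_
  ; _∙_                    = _⊕_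
  ; isCommutativeSemigroup = record
    { isSemigroup = record
      { isMagma = record { isEquivalence = isEquivalence ; ∙-cong = cong₂ _⊕_ }
      ; assoc   = ⊕-assoc
      }
    ; comm = ⊕-comm
    }
  }

module ⊕-Properties (n : ℕ) = CommSemigroupProperties (⊕-commutativeSemigroup n)

Δ : (F n → F n) → F n → F n → F n
Δ f x y = f (x ⊕ y) ⊕ f x ⊕ f y

ω : P n → P n → F n
ω (x , x₁) (y , y₁) = (x₁ · y) ⊕ (y₁ · x)

ω-⊞ʳ : (u v : P n) → ω u (u ⊞ v) ≡ ω u v
ω-⊞ʳ (x , false) (y , false) = refl
ω-⊞ʳ (x , false) (y , true)  = refl
ω-⊞ʳ (x , true)  (y , false) =
  trans (trans (⊕-comm (x ⊕ y) x) (⊕-cancelˡ x y)) (sym (⊕-identityʳ y))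
ω-⊞ʳ (x , true)  (y , true)  = trans (⊕-identityʳ (x ⊕ y)) (⊕-comm x y)

ω-⊞ˡ : (u v : P n) → ω v (u ⊞ v) ≡ ω u v
ω-⊞ˡ (x , false) (y , false) = refl
ω-⊞ˡ (x , false) (y , true)  = trans (⊕-cancelʳ x y) (sym (⊕-identityˡ x))
ω-⊞ˡ (x , true)  (y , false) = trans (⊕-identityˡ y) (sym (⊕-identityʳ y))
ω-⊞ˡ (x , true)  (y , true)  = trans (⊕-identityʳ (x ⊕ y)) (⊕-comm x y)

ω-comm : (u v : P n) → ω u v ≡ ω v u
ω-comm (x , x₁) (y , y₁) = ⊕-comm (x₁ · y) (y₁ · x)

module _ (f : F n → F n) where
  open ⊕-Properties n

  Δ-comm : (x y : F n) → Δ f x y ≡ Δ f y x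
  Δ-comm x y = begin
    f (x ⊕ y) ⊕ f x ⊕ f y ≡⟨ xy∙z≈xz∙y (f (x ⊕ y)) (f x) (f y) ⟩
    f (x ⊕ y) ⊕ f y ⊕ f x ≡⟨ cong (λ z → f z ⊕ f y ⊕ f x) (⊕-comm x y) ⟩
    f (y ⊕ x) ⊕ f y ⊕ f x ∎
    where open ≡-Reasoning

  Δ-⊕ʳ : (x y : F n) → Δ f x (x ⊕ y) ≡ Δ f x y
  Δ-⊕ʳ x y = begin
    f (x ⊕ (x ⊕ y)) ⊕ f x ⊕ f (x ⊕ y) ≡⟨ cong (λ z → f z ⊕ f x ⊕ f (x ⊕ y)) (⊕-cancelˡ x y) ⟩
    f y ⊕ f x ⊕ f (x ⊕ y)             ≡⟨ xy∙z≈zy∙x (f y) (f x) (f (x ⊕ y)) ⟩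
    f (x ⊕ y) ⊕ f x ⊕ f y             ∎
    where open ≡-Reasoning

  Δ-⊕ˡ : (x y : F n) → Δ f y (x ⊕ y) ≡ Δ f x y
  Δ-⊕ˡ x y = begin
    Δ f y (x ⊕ y) ≡⟨ cong (Δ f y) (⊕-comm x y) ⟩
    Δ f y (y ⊕ x) ≡⟨ Δ-⊕ʳ y x ⟩
    Δ f y x       ≡⟨ Δ-comm y x ⟩
    Δ f x y       ∎
    where open ≡-Reasoning

  c-⊞ʳ : (u v : P n) → c f u (u ⊞ v) ≡ c f u v
  c-⊞ʳ u@(x , _) v@(y , _) = cong₂ _⊕_ (Δ-⊕ʳ x y) (cong f (ω-⊞ʳ u v))

  c-⊞ˡ : (u v : P n) → c f v (u ⊞ v) ≡ c f u v
  c-⊞ˡ u@(x , _) v@(y , _) = cong₂ _⊕_ (Δ-⊕ˡ x y) (cong f (ω-⊞ˡ u v))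

  c-comm : (u v : P n) → c f u v ≡ c f v u
  c-comm u@(x , _) v@(y , _) = cong₂ _⊕_ (Δ-comm x y) (cong f (ω-comm u v))

module _ {f : F n → F n} (crooked : Crooked f) where
  open Crooked crooked
  open ⊕-Properties n

  Δ≢𝟎 : {x y : F n} → x ≢ 𝟎 → y ≢ 𝟎 → x ≢ y → Δ f x y ≢ 𝟎
  Δ≢𝟎 {x} {y} x≢𝟎 y≢𝟎 x≢y = subst (_≢ 𝟎) cond2≡Δ (cond2 x y 𝟎 x≢y x≢𝟎 y≢𝟎)
    where
    open ≡-Reasoning
    cond2≡Δ : f x ⊕ f y ⊕ f 𝟎 ⊕ f (x ⊕ y ⊕ 𝟎) ≡ Δ f x y
    cond2≡Δ = begin
      f x ⊕ f y ⊕ f 𝟎 ⊕ f (x ⊕ y ⊕ 𝟎) ≡⟨ cong₂ (λ a b → f x ⊕ f y ⊕ a ⊕ f b) zero-fixed (⊕-identityʳ (x ⊕ y)) ⟩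
      f x ⊕ f y ⊕ 𝟎 ⊕ f (x ⊕ y)       ≡⟨ cong (_⊕ f (x ⊕ y)) (⊕-identityʳ (f x ⊕ f y)) ⟩
      f x ⊕ f y ⊕ f (x ⊕ y)           ≡⟨ xy∙z≈zx∙y (f x) (f y) (f (x ⊕ y)) ⟩
      Δ f x y                         ∎

  f[x]⊕f[x⊕a]≢𝟎 : {a : F n} → a ≢ 𝟎 → (x : F n) → f x ⊕ f (x ⊕ a) ≢ 𝟎
  f[x]⊕f[x⊕a]≢𝟎 {a} a≢𝟎 x = subst (_≢ 𝟎) cond3≡ (cond3 a a≢𝟎 x x x)
    where
    open ≡-Reasoning
    p q : F n
    p = f x
    q = f (x ⊕ a)
    cond3≡ : p ⊕ p ⊕ p ⊕ q ⊕ q ⊕ q ≡ p ⊕ q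
    cond3≡ = begin
      p ⊕ p ⊕ p ⊕ q ⊕ q ⊕ q ≡⟨ ⊕-cancelʳ (p ⊕ p ⊕ p ⊕ q) q ⟩
      p ⊕ p ⊕ p ⊕ q         ≡⟨ cong (λ z → z ⊕ p ⊕ q) (⊕-self p) ⟩
      𝟎 ⊕ p ⊕ q             ≡⟨ cong (_⊕ q) (⊕-identityˡ p) ⟩
      p ⊕ q                 ∎

  c-hyperplane≢𝟎 : {x y : F n} → x ≢ 𝟎 → y ≢ 𝟎 → x ≢ y → c f (x , false) (y , false) ≢ 𝟎
  c-hyperplane≢𝟎 {x} {y} x≢𝟎 y≢𝟎 x≢y = subst (_≢ 𝟎) (sym c≡Δ) (Δ≢𝟎 x≢𝟎 y≢𝟎 x≢y)
    where
    open ≡-Reasoning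
    c≡Δ : c f (x , false) (y , false) ≡ Δ f x y
    c≡Δ = begin
      Δ f x y ⊕ f (𝟎 ⊕ 𝟎) ≡⟨ cong (λ z → Δ f x y ⊕ f z) (⊕-self 𝟎) ⟩
      Δ f x y ⊕ f 𝟎       ≡⟨ cong (Δ f x y ⊕_) zero-fixed ⟩
      Δ f x y ⊕ 𝟎         ≡⟨ ⊕-identityʳ (Δ f x y) ⟩
      Δ f x y             ∎

  c-transversal≢𝟎 : (x : F n) {y : F n} → y ≢ 𝟎 → c f (x , true) (y , false) ≢ 𝟎
  c-transversal≢𝟎 x {y} y≢𝟎 = subst (_≢ 𝟎) (sym c≡) (f[x]⊕f[x⊕a]≢𝟎 y≢𝟎 x)
    where
    open ≡-Reasoning
    c≡ : c f (x , true) (y , false) ≡ f x ⊕ f (x ⊕ y)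
    c≡ = begin
      Δ f x y ⊕ f (y ⊕ 𝟎)  ≡⟨ cong (λ z → Δ f x y ⊕ f z) (⊕-identityʳ y) ⟩
      Δ f x y ⊕ f y        ≡⟨ ⊕-cancelʳ (f (x ⊕ y) ⊕ f x) (f y) ⟩
      f (x ⊕ y) ⊕ f x      ≡⟨ ⊕-comm (f (x ⊕ y)) (f x) ⟩
      f x ⊕ f (x ⊕ y)      ∎

  c≢𝟎 : {u v : P n} → u ≢ 𝟎ₚ → v ≢ 𝟎ₚ → u ≢ v → c f u v ≢ 𝟎
  c≢𝟎 {x , false} {y , false} u≢𝟎 v≢𝟎 u≢v =
    c-hyperplane≢𝟎 (u≢𝟎 ∘ cong (_, false)) (v≢𝟎 ∘ cong (_, false)) (u≢v ∘ cong (_, false))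
  c≢𝟎 {x , true}  {_ , false} _ v≢𝟎 _ = c-transversal≢𝟎 x (v≢𝟎 ∘ cong (_, false))
  c≢𝟎 {u@(_ , false)} {v@(y , true)} u≢𝟎 _ _ =
    subst (_≢ 𝟎) (c-comm f v u) (c-transversal≢𝟎 y (u≢𝟎 ∘ cong (_, false)))
  c≢𝟎 {u@(x , true)}  {v@(y , true)} _ _ u≢v =
    subst (_≢ 𝟎) (c-⊞ʳ f u v) (c-transversal≢𝟎 x (u≢v ∘ cong (_, true) ∘ ⊕≡𝟎⇒≡ x y))

lemma5 : (n : ℕ) (f : F n → F n) → Crooked f →
         (u v : P n) → u ≢ 𝟎ₚ → v ≢ 𝟎ₚ → u ≢ v →
         (c f u v ≡ c f u (u ⊞ v)) × (c f u v ≡ c f v (u ⊞ v)) × (c f u v ≢ 𝟎)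
lemma5 n f crooked u v u≢𝟎 v≢𝟎 u≢v =
  sym (c-⊞ʳ f u v) , sym (c-⊞ˡ f u v) , c≢𝟎 crooked u≢𝟎 v≢𝟎 u≢v
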